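{- Let $t$ be a $\lambda\mu$-term, $y$ a $\lambda$-variable, $\alpha$ a $\mu$-variable, and $A,B,C$ types. If $\Gamma, y:B\vdash t[\alpha:=^*y]:A\,;\ \alpha:C,\Delta$, then $\Gamma,y:B\vdash t:A\,;\ \alpha:B\to C,\Delta$.
   Context: $\lambda\mu$-terms over disjoint infinite sets of $\lambda$-variables and $\mu$-variables: $t ::= x \mid \lambda x.t \mid (t\,t) \mid \mu\alpha.t \mid (\alpha\,t)$. $u[\alpha:=^*v]$ is obtained from $u$ by replacing inductively each subterm of the form $(\alpha\,w)$ by $(\alpha\,(w\,v))$. Types: $A ::= X\mid\perp\mid A\to A$ ($X$ propositional variables, $\perp$ a constant). Typing judgements $\Gamma\vdash t:A;\Delta$ with $\Gamma$ a set of declarations $x:A$ for distinct $\lambda$-variables and $\Delta$ a set of declarations $\alpha:B$ for distinct $\mu$-variables, derived by: (ax) $\Gamma\vdash x:A;\Delta$ if $x:A\in\Gamma$; ($\to_i$) from $\Gamma,x:A\vdash t:B;\Delta$ infer $\Gamma\vdash\lambda x.t:A\to B;\Delta$; ($\to_e$) from $\Gamma\vdash u:A\to B;\Delta$ and $\Gamma\vdash v:A;\Delta$ infer $\Gamma\vdash(u\,v):B;\Delta$; ($\mu$) from $\Gamma\vdash t:\perp;\Delta,\alpha:A$ infer $\Gamma\vdash\mu\alpha.t:A;\Delta$; ($\perp$) from $\Gamma\vdash t:A;\Delta,\alpha:A$ infer $\Gamma\vdash(\alpha\,t):\perp;\Delta,\alpha:A$. -}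

module Defs where

open import Data.Nat using (ℕ; zero; suc; _≡ᵇ_)
open import Data.Bool using (if_then_else_)
open import Data.List using (List; []; _∷_)

data Ty : Set where
  `_  : ℕ → Ty
  ⊥ₜ  : Ty
  _⇒_ : Ty → Ty → Ty

infixr 7 _⇒_

-- λμ-terms, with λ-variables and μ-variables as two separate (hence disjoint)
-- sorts of de Bruijn indices (terms are thereby identified up to α-conversion).
--   var x      = x
--   lam t      = λx.t        (binds λ-index 0 in t)
--   app u v    = (u v)
--   mu t       = μα.t        (binds μ-index 0 in t)
--   name α t   = (α t)
data Term : Set where
  var  : ℕ → Term
  lam  : Term → Term
  app  : Term → Term → Term
  mu   : Term → Term
  name : ℕ → Term → Term

-- u[α :=* y] for a μ-variable α and a λ-variable y:
-- replace every subterm (α w) by (α (w y)), going under binders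
-- (indices of α and y are shifted when crossing μ- resp. λ-binders,
--  so the substitution is capture-avoiding).
_[_:=*_] : Term → ℕ → ℕ → Term
var x    [ α :=* y ] = var x
lam t    [ α :=* y ] = lam (t [ α :=* suc y ])
app u v  [ α :=* y ] = app (u [ α :=* y ]) (v [ α :=* y ])
mu t     [ α :=* y ] = mu (t [ suc α :=* y ])
name β t [ α :=* y ] =
  if β ≡ᵇ α then name β (app (t [ α :=* y ]) (var y))
            else name β (t [ α :=* y ])

data _∋_∶_ : List Ty → ℕ → Ty → Set where
  here  : ∀ {Γ A} → (A ∷ Γ) ∋ zero ∶ A
  there : ∀ {Γ A B n} → Γ ∋ n ∶ A → (B ∷ Γ) ∋ suc n ∶ A

data _⊢_∶_∣_ : List Ty → Term → Ty → List Ty → Set where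
  ax   : ∀ {Γ Δ x A} → Γ ∋ x ∶ A → Γ ⊢ var x ∶ A ∣ Δ
  →i   : ∀ {Γ Δ t A B} → (A ∷ Γ) ⊢ t ∶ B ∣ Δ → Γ ⊢ lam t ∶ A ⇒ B ∣ Δ
  →e   : ∀ {Γ Δ u v A B} → Γ ⊢ u ∶ A ⇒ B ∣ Δ → Γ ⊢ v ∶ A ∣ Δ → Γ ⊢ app u v ∶ B ∣ Δ
  μr   : ∀ {Γ Δ t A} → Γ ⊢ t ∶ ⊥ₜ ∣ (A ∷ Δ) → Γ ⊢ mu t ∶ A ∣ Δ
  ⊥r   : ∀ {Γ Δ α t A} → Δ ∋ α ∶ A → Γ ⊢ t ∶ A ∣ Δ → Γ ⊢ name α t ∶ ⊥ₜ ∣ Δ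

module Submission where

-- The substitution t[α :=* y] only changes the named
-- subterms (α w) into (α (w y)).  Reading a derivation of the substituted
-- term backwards, every such (α (w y)) was typed by giving (w y) the type C
-- declared for α, with y : B; hence w itself has type B ⇒ C.  Giving α the
-- type B ⇒ C instead of C therefore types the original term t.
--
-- Going under a μ-binder shifts α, and going under a λ-binder shifts y,
-- so the statement is first generalised to an arbitrary λ-variable y with
-- Γ ∋ y ∶ B and an arbitrary position α in the μ-context.

open import Defs
open import Data.List using (List; _∷_)
open import Data.Nat using (ℕ; zero; suc; _≡ᵇ_)
open import Data.Nat.Properties using (≡ᵇ⇒≡; ≡⇒≡ᵇ)
open import Data.Bool using (true; false; T)
open import Data.Bool.Properties using (T-≡)
open import Function.Bundles using (Equivalence)
open import Relation.Binary.PropositionalEquality using (_≡_; _≢_; refl; cong; subst)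
open import Relation.Nullary using (contradiction)

≡ᵇ-true⇒≡ : ∀ {m n} → (m ≡ᵇ n) ≡ true → m ≡ n
≡ᵇ-true⇒≡ {m} {n} m≡ᵇn = ≡ᵇ⇒≡ m n (Equivalence.from T-≡ m≡ᵇn)

≡ᵇ-false⇒≢ : ∀ {m n} → (m ≡ᵇ n) ≡ false → m ≢ n
≡ᵇ-false⇒≢ {m} {n} m≢ᵇn m≡n = subst T m≢ᵇn (≡⇒≡ᵇ m n m≡n)

lookup-unique : ∀ {Γ n X Y} → Γ ∋ n ∶ X → Γ ∋ n ∶ Y → X ≡ Y
lookup-unique here      here      = refl
lookup-unique (there p) (there q) = lookup-unique p q

data Retyped : List Ty → ℕ → Ty → Ty → List Ty → Set where
  here  : ∀ {Δ C D} → Retyped (C ∷ Δ) zero C D (D ∷ Δ)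
  there : ∀ {Δ Δ' α C D E} → Retyped Δ α C D Δ' → Retyped (E ∷ Δ) (suc α) C D (E ∷ Δ')

retyped-old : ∀ {Δ α C D Δ'} → Retyped Δ α C D Δ' → Δ ∋ α ∶ C
retyped-old here      = here
retyped-old (there r) = there (retyped-old r)

retyped-new : ∀ {Δ α C D Δ'} → Retyped Δ α C D Δ' → Δ' ∋ α ∶ D
retyped-new here      = here
retyped-new (there r) = there (retyped-new r)

retyped-other : ∀ {Δ α C D Δ' β X} → Retyped Δ α C D Δ' → β ≢ α → Δ ∋ β ∶ X → Δ' ∋ β ∶ X
retyped-other here      β≢α here      = contradiction refl β≢α
retyped-other here      β≢α (there p) = there p
retyped-other (there r) β≢α here      = here
retyped-other (there r) β≢α (there p) = there (retyped-other r (λ β≡α → β≢α (cong suc β≡α)) p)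

unsubstitute : ∀ t {Γ Δ Δ' α y A B C} → Γ ∋ y ∶ B → Retyped Δ α C (B ⇒ C) Δ'
             → Γ ⊢ t [ α :=* y ] ∶ A ∣ Δ → Γ ⊢ t ∶ A ∣ Δ'
unsubstitute (var x)    y∶B r (ax x∶A) = ax x∶A
unsubstitute (lam t)    y∶B r (→i d)   = →i (unsubstitute t (there y∶B) r d)
unsubstitute (app u v)  y∶B r (→e d e) = →e (unsubstitute u y∶B r d) (unsubstitute v y∶B r e)
unsubstitute (mu t)     y∶B r (μr d)   = μr (unsubstitute t y∶B (there r) d)
unsubstitute (name β t) {α = α} y∶B r d with β ≡ᵇ α in β≡ᵇα
-- β is α: the derivation types (t y) with the type C of α, and y : B,
-- so t : B ⇒ C, which is the new type of α.
... | true with ≡ᵇ-true⇒≡ {β} {α} β≡ᵇα | d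
...   | refl | ⊥r α∶C (→e d′ (ax y∶B′))
        with lookup-unique α∶C (retyped-old r) | lookup-unique y∶B′ y∶B
...     | refl | refl = ⊥r (retyped-new r) (unsubstitute t y∶B r d′)
unsubstitute (name β t) y∶B r (⊥r β∶X d) | false =
  ⊥r (retyped-other r (≡ᵇ-false⇒≢ β≡ᵇα) β∶X) (unsubstitute t y∶B r d)

lemma3p4 : (Γ Δ : List Ty) (t : Term) (A B C : Ty)
    → (B ∷ Γ) ⊢ t [ 0 :=* 0 ] ∶ A ∣ (C ∷ Δ)
    → (B ∷ Γ) ⊢ t ∶ A ∣ ((B ⇒ C) ∷ Δ)
lemma3p4 Γ Δ t A B C d = unsubstitute t here here d
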